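{- Let $\sigma$ be a unimodal vocabulary, $k>0$, and $(\mathcal{A},a)$ a pointed $\sigma$-structure. There is a bijective correspondence between $\mathbb{H}_k$-coalgebras $\alpha:(\mathcal{A},a)\to\mathbb{H}_k(\mathcal{A},a)$ and generated tree covers of $(\mathcal{A},a)$ of height at most $k+1$.
   Context: A unimodal vocabulary consists of unary predicate symbols and one binary relation symbol $E$. Pointed structures $(\mathcal{A},a)$, $a\in A$; morphisms are homomorphisms preserving the point. $\mathbb{H}_k(\mathcal{A},a)$: universe the sequences $\langle a_0,\ldots,a_l\rangle$, $0\le l\le k$, $a_0=a$, with each $a_j$ ($j>0$) satisfying $E^{\mathcal{A}}(a_i,a_j)$ for some $i<j$; with $\varepsilon(s)$ the last element and $\sqsubseteq$ the prefix order, $P(s)$ iff $P^{\mathcal{A}}(\varepsilon(s))$, $E(s,t)$ iff $s,t$ comparable and $E^{\mathcal{A}}(\varepsilon(s),\varepsilon(t))$; point $\langle a\rangle$. For a morphism $f$, $\mathbb{H}_kf(\langle a_0,\ldots,a_l\rangle)=\langle f(a_0),\ldots,f(a_l)\rangle$, and $\delta:\mathbb{H}_k(\mathcal{A},a)\to\mathbb{H}_k\mathbb{H}_k(\mathcal{A},a)$ sends $s$ to the sequence of its nonempty prefixes $\langle\langle a_0\rangle,\langle a_0,a_1\rangle,\ldots,s\rangle$. An $\mathbb{H}_k$-coalgebra is a morphism $\alpha:(\mathcal{A},a)\to\mathbb{H}_k(\mathcal{A},a)$ with $\varepsilon\circ\alpha=\mathrm{id}$ and $\delta\circ\alpha=\mathbb{H}_k\alpha\circ\alpha$.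 A forest is a poset in which the predecessors of each element form a finite chain; a tree is a forest with a least element; the height is the supremum of cardinalities of chains. The Gaifman graph of $\mathcal{A}$ has distinct elements adjacent iff they occur together in some tuple of some relation. A tree cover of $(\mathcal{A},a)$ is a tree order $\le$ on $A$ with least element $a$ such that Gaifman-adjacent elements are $\le$-comparable; it is generated if for every $a'\ne a$ there is $a''<a'$ with $E^{\mathcal{A}}(a'',a')$. -}

module Defs where

open import Level using (Level; _⊔_) renaming (suc to lsuc)
open import Data.Nat using (ℕ; zero; suc; s≤s; z≤n) renaming (_≤_ to _≤ℕ_)
open import Data.Fin using (Fin; toℕ) renaming (zero to fzero; _<_ to _<ᶠ_)
open import Data.List as List using (List; []; _∷_; _++_; lookup)
open import Data.List.NonEmpty as List⁺ using (List⁺; _∷_; _∷⁺_; toList; last; head)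
open import Data.List.Membership.Propositional using (_∈_)
open import Data.List.Relation.Unary.Unique.Propositional using (Unique)
open import Data.Product using (Σ; ∃; ∃-syntax; _×_; _,_; proj₁)
open import Data.Sum using (_⊎_)
open import Relation.Nullary using (¬_)
open import Relation.Binary.PropositionalEquality using (_≡_; _≢_; refl)
open import Relation.Binary.Structures using (IsPartialOrder; IsEquivalence)
open import Relation.Binary.Bundles using (Setoid)
open import Function.Bundles using (_⇔_)
open import Function.Properties.Equivalence using (⇔-isEquivalence)

-- Unimodal vocabulary: an index type σ of unary predicate symbols and one
-- binary relation symbol E.  A pointed σ-structure (𝒜 , a):

record PStructure {ℓ : Level} (σ : Set ℓ) : Set (lsuc ℓ) where
  field
    Carrier : Set ℓ
    P       : σ → Carrier → Set ℓ
    E       : Carrier → Carrier → Set ℓ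
    point   : Carrier

module _ {ℓ : Level} {A : Set ℓ} where

  ε : List⁺ A → A
  ε = last

  _⊑_ : List⁺ A → List⁺ A → Set ℓ
  s ⊑ t = ∃[ u ] (toList s ++ u ≡ toList t)

  Comparable : List⁺ A → List⁺ A → Set ℓ
  Comparable s t = (s ⊑ t) ⊎ (t ⊑ s)

  prefixesFrom : A → List A → List⁺ (List⁺ A)
  prefixesFrom x []       = (x ∷ []) ∷ []
  prefixesFrom x (y ∷ ys) = (x ∷ []) ∷ toList (List⁺.map (x ∷⁺_) (prefixesFrom y ys))

  δ : List⁺ A → List⁺ (List⁺ A)
  δ (x ∷ xs) = prefixesFrom x xs

ℍmap : ∀ {ℓ} {A B : Set ℓ} → (A → B) → List⁺ A → List⁺ B
ℍmap = List⁺.map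

module _ {ℓ : Level} {σ : Set ℓ} (k : ℕ) (𝒜 : PStructure σ) where
  open PStructure 𝒜

  record InHk (s : List⁺ Carrier) : Set ℓ where
    field
      len   : List⁺.length s ≤ℕ suc k
      start : head s ≡ point
      gen   : (j : Fin (List.length (toList s))) → toℕ j ≢ 0 →
              ∃[ i ] (i <ᶠ j × E (lookup (toList s) i) (lookup (toList s) j))

  HkCarrier : Set ℓ
  HkCarrier = Σ (List⁺ Carrier) InHk

  seq : HkCarrier → List⁺ Carrier
  seq = proj₁

  pointInHk : InHk (point ∷ [])
  pointInHk = record
    { len = s≤s z≤n
    ; start = refl
    ; gen = λ { fzero j≢0 → Relation.Nullary.contradiction refl j≢0 } }
    where import Relation.Nullary

  ℍ : PStructure σ
  ℍ = record
    { Carrier = HkCarrier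
    ; P = λ p s → P p (ε (seq s))
    ; E = λ s t → Comparable (seq s) (seq t) × E (ε (seq s)) (ε (seq t))
    ; point = (point ∷ []) , pointInHk
    }

-- ℍ_k-coalgebras on (𝒜, a).
-- Elements of ℍ_k(𝒜,a) are sequences; their equality is equality of the
-- underlying sequences (the Σ-component only witnesses membership).

module _ {ℓ : Level} {σ : Set ℓ} (k : ℕ) (𝒜 : PStructure σ) where
  open PStructure 𝒜
  private module H = PStructure (ℍ k 𝒜)

  record Coalgebra : Set ℓ where
    field
      α        : Carrier → HkCarrier k 𝒜
      pres-P   : ∀ p x → P p x → H.P p (α x)
      pres-E   : ∀ x y → E x y → H.E (α x) (α y)
      pres-pt  : seq k 𝒜 (α point) ≡ point ∷ []
      counit   : ∀ x → ε (seq k 𝒜 (α x)) ≡ x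
      coassoc  : ∀ x → δ (seq k 𝒜 (α x)) ≡ ℍmap (λ y → seq k 𝒜 (α y)) (seq k 𝒜 (α x))

  CoalgSetoid : Setoid ℓ ℓ
  CoalgSetoid = record
    { Carrier = Coalgebra
    ; _≈_ = λ c d → ∀ x → seq k 𝒜 (Coalgebra.α c x) ≡ seq k 𝒜 (Coalgebra.α d x)
    ; isEquivalence = record
      { refl = λ x → refl
      ; sym = λ p x → Relation.Binary.PropositionalEquality.sym (p x)
      ; trans = λ p q x → Relation.Binary.PropositionalEquality.trans (p x) (q x) } }
    where import Relation.Binary.PropositionalEquality

-- Gaifman graph (for a unimodal vocabulary only E contributes pairs)

module _ {ℓ : Level} {σ : Set ℓ} (𝒜 : PStructure σ) where
  open PStructure 𝒜

  Gaifman : Carrier → Carrier → Set ℓ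
  Gaifman x y = x ≢ y × (E x y ⊎ E y x)

module _ {ℓ : Level} {A : Set ℓ} (_≤_ : A → A → Set ℓ) where

  Strict : A → A → Set ℓ
  Strict x y = x ≤ y × x ≢ y

  IsFinite : (A → Set ℓ) → Set ℓ
  IsFinite S = ∃[ l ] (Unique l × (∀ y → S y ⇔ y ∈ l))

  IsChainSet : (A → Set ℓ) → Set ℓ
  IsChainSet S = ∀ y z → S y → S z → (y ≤ z) ⊎ (z ≤ y)

  IsChainList : List A → Set ℓ
  IsChainList l = ∀ y z → y ∈ l → z ∈ l → (y ≤ z) ⊎ (z ≤ y)

  record IsForest : Set ℓ where
    field
      isPartialOrder : IsPartialOrder _≡_ _≤_
      predFinite     : ∀ x → IsFinite (λ y → y ≤ x)
      predChain      : ∀ x → IsChainSet (λ y → y ≤ x)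

  HeightAtMost : ℕ → Set ℓ
  HeightAtMost h = ∀ (l : List A) → Unique l → IsChainList l → List.length l ≤ℕ h

module _ {ℓ : Level} {σ : Set ℓ} (𝒜 : PStructure σ) where
  open PStructure 𝒜

  record TreeCover : Set (lsuc ℓ) where
    field
      _≤_      : Carrier → Carrier → Set ℓ
      isForest : IsForest _≤_
      least    : ∀ x → point ≤ x
      -- Gaifman-adjacent elements are comparable.  For a unimodal vocabulary,
      -- distinct x, y are Gaifman-adjacent iff E x y or E y x (see Gaifman);
      -- since ≤ is reflexive this is exactly: E-related elements are comparable.
      covers   : ∀ x y → E x y → (x ≤ y) ⊎ (y ≤ x)

  Generated : TreeCover → Set ℓ
  Generated T = ∀ x → x ≢ point → ∃[ y ] (Strict _≤_ y x × E y x)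
    where open TreeCover T

module _ {ℓ : Level} {σ : Set ℓ} (k : ℕ) (𝒜 : PStructure σ) where

  record GenTreeCover : Set (lsuc ℓ) where
    field
      cover     : TreeCover 𝒜
      generated : Generated 𝒜 cover
      height    : HeightAtMost (TreeCover._≤_ cover) (suc k)

  GenTreeCoverSetoid : Setoid (lsuc ℓ) ℓ
  GenTreeCoverSetoid = record
    { Carrier = GenTreeCover
    ; _≈_ = λ T U → ∀ x y → TreeCover._≤_ (GenTreeCover.cover T) x y
                          ⇔ TreeCover._≤_ (GenTreeCover.cover U) x y
    ; isEquivalence = record
      { refl = λ x y → IsEquivalence.refl ⇔-isEquivalence
      ; sym = λ p x y → IsEquivalence.sym ⇔-isEquivalence (p x y)
      ; trans = λ p q x y → IsEquivalence.trans ⇔-isEquivalence (p x y) (q x y) } }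

-- A coalgebra α sends x to a sequence ending in x (counit) every prefix of which is again
-- the image under α of its last entry (coassociativity).  Hence α x lists, in increasing
-- order, the predecessors of x for the order  x ≤ y ⟺ α x ⊑ α y,  which is then a tree
-- order rooted at a.  Since α preserves E this tree covers 𝒜, and the conditions defining
-- ℍ_k (every entry is E-reached from an earlier one; length at most k+1) make it generated
-- and of height at most k+1.  Conversely a tree cover sends x to its branch: the finitely
-- many predecessors of x, sorted along the chain they form.  Both round trips are the
-- identity because a branch is the unique strictly ascending enumeration of a down-set.
module Submission where

open import Defs
open import Level using (Level)
open import Data.Nat using (ℕ; _<_)
open import Function.Bundles using (Inverse)

open import Data.Nat using (suc; s≤s; _≤?_) renaming (_≤_ to _≤ℕ_)
open import Data.Nat.Properties using (≰⇒>; <⇒≱; suc-injective)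
open import Data.Fin using (Fin; toℕ; fromℕ; fromℕ<)
  renaming (zero to fzero; suc to fsuc; _<_ to _<ᶠ_)
open import Data.Fin.Properties
  using (toℕ-injective; toℕ-fromℕ; toℕ≤pred[n]; pigeonhole; fromℕ<-injective; <-cmp)
open import Data.List as List using (List; []; _∷_; _++_; lookup; length; map)
open import Data.List.Properties
  using ( ++-assoc; ∷-injective; map-∘; map-cong; map-injective
        ; ++-identityʳ; ++-identityʳ-unique; ++-conicalˡ; ++-conicalʳ)
open import Data.List.NonEmpty as List⁺ using (List⁺; _∷_; _∷⁺_; toList; last; head; tail)
open import Data.List.Membership.Propositional using (_∈_)
open import Data.List.Membership.Propositional.Properties using (∈-∃++; ∈-++⁺ˡ; ∈-++⁺ʳ; ∈-++⁻; ∈-lookup)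
open import Data.List.Relation.Unary.All as All using (All; []; _∷_)
open import Data.List.Relation.Unary.Any as Any using (here; there)
open import Data.List.Relation.Unary.Any.Properties using (lookup-index)
open import Data.List.Relation.Unary.AllPairs as AllPairs using (AllPairs; []; _∷_)
open import Data.List.Relation.Unary.Unique.Propositional using (Unique)
open import Data.List.Relation.Binary.Permutation.Propositional using (_↭_; ↭-refl; ↭-sym; ↭-trans; prep; swap)
open import Data.List.Relation.Binary.Permutation.Propositional.Properties using (All-resp-↭; ∈-resp-↭)
open import Data.Product using (∃; ∃-syntax; _×_; _,_; proj₁; proj₂)
open import Data.Sum as Sum using (_⊎_; inj₁; inj₂)
open import Data.Empty using (⊥-elim)
open import Function using (_∘_)
open import Function.Bundles using (_⇔_; mk⇔; Equivalence)
open import Function.Definitions using (Congruent; StrictlyInverseˡ; StrictlyInverseʳ; Inverseˡ; Inverseʳ)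
open import Relation.Nullary using (¬_; yes; no)
open import Relation.Binary.Definitions using (tri<; tri≈; tri>)
open import Relation.Binary.PropositionalEquality
  using (_≡_; _≢_; refl; sym; trans; cong; cong₂; subst; subst₂; ≢-sym; isEquivalence; module ≡-Reasoning)
open import Relation.Binary.Structures using (IsPartialOrder)
open import Relation.Binary.Bundles using (Setoid)
open import Function.Properties.Equivalence using () renaming (sym to ⇔-sym)

open ≡-Reasoning

toList-injective : ∀ {ℓ} {A : Set ℓ} {s t : List⁺ A} → toList s ≡ toList t → s ≡ t
toList-injective {s = _ ∷ _} {_ ∷ _} refl = refl

module _ {ℓ : Level} {A : Set ℓ} where

  toList-init-last : (s : List⁺ A) → ∃ λ init → toList s ≡ init ++ last s ∷ []
  toList-init-last (x ∷ xs) with List.initLast xs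
  ... | []                = [] , refl
  ... | init List.∷ʳ′ y = x ∷ init , refl

  ++-prefixes-comparable : (xs ys : List A) {u v : List A} → xs ++ u ≡ ys ++ v →
                           (∃ λ w → xs ++ w ≡ ys) ⊎ (∃ λ w → ys ++ w ≡ xs)
  ++-prefixes-comparable []       ys       _ = inj₁ (ys , refl)
  ++-prefixes-comparable (x ∷ xs) []       _ = inj₂ (x ∷ xs , refl)
  ++-prefixes-comparable (x ∷ xs) (y ∷ ys) e with ∷-injective e
  ... | refl , e′ with ++-prefixes-comparable xs ys e′
  ... | inj₁ (w , e″) = inj₁ (w , cong (x ∷_) e″)
  ... | inj₂ (w , e″) = inj₂ (w , cong (x ∷_) e″)

  ++-antisym : (xs : List A) {ys u v : List A} → xs ++ u ≡ ys → ys ++ v ≡ xs → xs ≡ ys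
  ++-antisym xs {ys} {u} {v} e₁ e₂ = begin
      xs       ≡⟨ sym (++-identityʳ xs) ⟩
      xs ++ [] ≡⟨ cong (xs ++_) (sym u≡[]) ⟩
      xs ++ u  ≡⟨ e₁ ⟩
      ys       ∎
    where
    u≡[] : u ≡ []
    u≡[] = ++-conicalˡ u v (++-identityʳ-unique xs (sym (begin
      xs ++ u ++ v   ≡⟨ sym (++-assoc xs u v) ⟩
      (xs ++ u) ++ v ≡⟨ cong (_++ v) e₁ ⟩
      ys ++ v        ≡⟨ e₂ ⟩
      xs             ∎)))

  ++-prefix-of-equal-length : (xs : List A) {u ys : List A} → xs ++ u ≡ ys → length xs ≡ length ys → xs ≡ ys
  ++-prefix-of-equal-length []       {[]}    {[]}     refl _  = refl
  ++-prefix-of-equal-length []       {_ ∷ _} {_ ∷ _}  refl ()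
  ++-prefix-of-equal-length (x ∷ xs) {u} {y ∷ ys} e l with ∷-injective e
  ... | refl , e′ = cong (x ∷_) (++-prefix-of-equal-length xs e′ (suc-injective l))

  module _ {r : Level} {R : A → A → Set r} where

    allPairs-++⁻ : (xs : List A) {ys : List A} → AllPairs R (xs ++ ys) →
                   AllPairs R xs × AllPairs R ys × All (λ x → All (R x) ys) xs
    allPairs-++⁻ []       p        = [] , p , []
    allPairs-++⁻ (x ∷ xs) (px ∷ p) with allPairs-++⁻ xs p
    ... | pxs , pys , across =
      All.tabulate (All.lookup px ∘ ∈-++⁺ˡ) ∷ pxs , pys ,
      All.tabulate (All.lookup px ∘ ∈-++⁺ʳ xs) ∷ across

    allPairs-++-across : (xs : List A) {ys : List A} {x y : A} → AllPairs R (xs ++ ys) → x ∈ xs → y ∈ ys → R x y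
    allPairs-++-across xs p x∈ y∈ = All.lookup (All.lookup (proj₂ (proj₂ (allPairs-++⁻ xs p))) x∈) y∈

    allPairs-lookup : ∀ {l} → AllPairs R l → ∀ {i j} → i <ᶠ j → R (lookup l i) (lookup l j)
    allPairs-lookup (px ∷ _) {fzero}  {fsuc j} _ = All.lookup px (∈-lookup j)
    allPairs-lookup (_ ∷ p)  {fsuc i} {fsuc j} (s≤s i<j) = allPairs-lookup p i<j

  Prefixing : (A → List A) → List A → List A → Set ℓ
  Prefixing f acc xs = ∀ pre a post → xs ≡ pre ++ a ∷ post → f a ≡ acc ++ pre ++ a ∷ []

  prefixing-⊑ : ∀ {f : A → List⁺ A} {s} → Prefixing (toList ∘ f) [] (toList s) →
                ∀ {x} → x ∈ toList s → f x ⊑ s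
  prefixing-⊑ {f} {s} closed {x} x∈ with ∈-∃++ x∈
  ... | pre , post , e = post , (begin
      toList (f x) ++ post     ≡⟨ cong (_++ post) (closed pre x post e) ⟩
      (pre ++ x ∷ []) ++ post  ≡⟨ ++-assoc pre (x ∷ []) post ⟩
      pre ++ x ∷ post          ≡⟨ sym e ⟩
      toList s                 ∎)

  private
    prefixesWith : List A → A → List A → List (List A)
    prefixesWith acc x xs = map ((acc ++_) ∘ toList) (toList (prefixesFrom x xs))

    prefixesWith-∷ : ∀ acc x y ys →
                     map ((acc ++_) ∘ toList ∘ (x ∷⁺_)) (toList (prefixesFrom y ys)) ≡
                     prefixesWith (acc ++ x ∷ []) y ys
    prefixesWith-∷ acc x y ys = map-cong (λ p → sym (++-assoc acc (x ∷ []) (toList p))) (toList (prefixesFrom y ys))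

  prefixesFrom⇒Prefixing : ∀ f acc x xs → prefixesWith acc x xs ≡ map f (x ∷ xs) → Prefixing f acc (x ∷ xs)
  prefixesFrom⇒Prefixing f acc x []       h [] a post e with ∷-injective e
  ... | refl , _ = sym (proj₁ (∷-injective h))
  prefixesFrom⇒Prefixing f acc x (_ ∷ _)  h [] a post e with ∷-injective e
  ... | refl , _ = sym (proj₁ (∷-injective h))
  prefixesFrom⇒Prefixing f acc x [] h (_ ∷ pre) a post e
    with ++-conicalʳ pre (a ∷ post) (sym (proj₂ (∷-injective e)))
  ... | ()
  prefixesFrom⇒Prefixing f acc x (y ∷ ys) h (_ ∷ pre) a post e with ∷-injective e
  ... | refl , e′ = trans (prefixesFrom⇒Prefixing f (acc ++ x ∷ []) y ys h′ pre a post e′)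
                          (++-assoc acc (x ∷ []) (pre ++ a ∷ []))
    where
    h′ : prefixesWith (acc ++ x ∷ []) y ys ≡ map f (y ∷ ys)
    h′ = trans (sym (prefixesWith-∷ acc x y ys))
               (trans (map-∘ (toList (prefixesFrom y ys))) (proj₂ (∷-injective h)))

  Prefixing⇒prefixesFrom : ∀ f acc x xs → Prefixing f acc (x ∷ xs) → prefixesWith acc x xs ≡ map f (x ∷ xs)
  Prefixing⇒prefixesFrom f acc x []       h = cong (_∷ []) (sym (h [] x [] refl))
  Prefixing⇒prefixesFrom f acc x (y ∷ ys) h = cong₂ _∷_ (sym (h [] x (y ∷ ys) refl)) (begin
      map ((acc ++_) ∘ toList) (map (x ∷⁺_) (toList (prefixesFrom y ys)))
        ≡⟨ sym (map-∘ (toList (prefixesFrom y ys))) ⟩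
      map (((acc ++_) ∘ toList) ∘ (x ∷⁺_)) (toList (prefixesFrom y ys))
        ≡⟨ prefixesWith-∷ acc x y ys ⟩
      prefixesWith (acc ++ x ∷ []) y ys
        ≡⟨ Prefixing⇒prefixesFrom f (acc ++ x ∷ []) y ys h′ ⟩
      map f (y ∷ ys) ∎)
    where
    h′ : Prefixing f (acc ++ x ∷ []) (y ∷ ys)
    h′ pre a post e = trans (h (x ∷ pre) a post (cong (x ∷_) e)) (sym (++-assoc acc (x ∷ []) (pre ++ a ∷ [])))

  δ≡map⇔Prefixing : (g : A → List⁺ A) (s : List⁺ A) →
                    (δ s ≡ List⁺.map g s) ⇔ Prefixing (toList ∘ g) [] (toList s)
  δ≡map⇔Prefixing g (x ∷ xs) = mk⇔
    (λ e → prefixesFrom⇒Prefixing (toList ∘ g) [] x xs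
             (trans (cong (map toList ∘ toList) e) (sym (map-∘ (x ∷ xs)))))
    (λ p → toList-injective (map-injective toList-injective
             (trans (Prefixing⇒prefixesFrom (toList ∘ g) [] x xs p) (map-∘ (x ∷ xs)))))

EdgeGenerated : ∀ {ℓ} {A : Set ℓ} → (A → A → Set ℓ) → List A → Set ℓ
EdgeGenerated E l = (j : Fin (length l)) → toℕ j ≢ 0 → ∃[ i ] (i <ᶠ j × E (lookup l i) (lookup l j))

module _ {ℓ : Level} {A : Set ℓ} (_≤_ : A → A → Set ℓ) where

  EdgeFromBelow : (A → A → Set ℓ) → A → Set ℓ
  EdgeFromBelow E x = ∃[ y ] (Strict _≤_ y x × E y x)

  record Branch (x : A) (l : List A) : Set ℓ where
    field
      ascending : AllPairs (Strict _≤_) l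
      complete  : ∀ {z} → z ≤ x → z ∈ l
      sound     : ∀ {z} → z ∈ l → z ≤ x

  branch-finite : ∀ {x l} → Branch x l → IsFinite _≤_ (_≤ x)
  branch-finite {l = l} b =
    l , AllPairs.map proj₂ (Branch.ascending b) , λ _ → mk⇔ (Branch.complete b) (Branch.sound b)

Branch-resp-⇔ : ∀ {ℓ} {A : Set ℓ} {R₁ R₂ : A → A → Set ℓ} → (∀ a b → R₁ a b ⇔ R₂ a b) →
                ∀ {x l} → Branch R₁ x l → Branch R₂ x l
Branch-resp-⇔ R₁⇔R₂ b = record
  { ascending = AllPairs.map (λ (p , ≢) → Equivalence.to (R₁⇔R₂ _ _) p , ≢) (Branch.ascending b)
  ; complete  = Branch.complete b ∘ Equivalence.from (R₁⇔R₂ _ _)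
  ; sound     = Equivalence.to (R₁⇔R₂ _ _) ∘ Branch.sound b
  }

module BranchProperties {ℓ : Level} {A : Set ℓ} {_≤_ : A → A → Set ℓ}
                        (isPartialOrder : IsPartialOrder _≡_ _≤_) where
  open IsPartialOrder isPartialOrder using (antisym) renaming (refl to ≤-refl; trans to ≤-trans)
  open Branch

  private
    _≺_ : A → A → Set ℓ
    _≺_ = Strict _≤_

  ≺⇒≱ : ∀ {x y} → x ≺ y → ¬ (y ≤ x)
  ≺⇒≱ (x≤y , x≢y) y≤x = x≢y (antisym x≤y y≤x)

  ascending-unique : ∀ {l₁ l₂} → AllPairs _≺_ l₁ → AllPairs _≺_ l₂ →
                     (∀ {z} → z ∈ l₁ → z ∈ l₂) → (∀ {z} → z ∈ l₂ → z ∈ l₁) → l₁ ≡ l₂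
  ascending-unique {[]}     {[]}     _ _ _ _ = refl
  ascending-unique {[]}     {b ∷ _}  _ _ _ ⊇ with ⊇ (here refl)
  ... | ()
  ascending-unique {a ∷ _}  {[]}     _ _ ⊆ _ with ⊆ (here refl)
  ... | ()
  ascending-unique {a ∷ l₁} {b ∷ l₂} (a≺ ∷ p₁) (b≺ ∷ p₂) ⊆ ⊇ =
    cong₂ _∷_ a≡b (ascending-unique p₁ p₂ (λ z∈ → drop-head a≺ a≡b z∈ (⊆ (there z∈)))
                                          (λ z∈ → drop-head b≺ (sym a≡b) z∈ (⊇ (there z∈))))
    where
    a≡b : a ≡ b
    a≡b with ⊆ (here refl) | ⊇ (here refl)
    ... | here a≡b  | _         = a≡b
    ... | there _   | here b≡a  = sym b≡a
    ... | there a∈₂ | there b∈₁ = ⊥-elim (≺⇒≱ (All.lookup a≺ b∈₁) (proj₁ (All.lookup b≺ a∈₂)))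
    drop-head : ∀ {a b l l′ z} → All (a ≺_) l → a ≡ b → z ∈ l → z ∈ b ∷ l′ → z ∈ l′
    drop-head a≺ a≡b z∈ (here z≡b) = ⊥-elim (proj₂ (All.lookup a≺ z∈) (trans a≡b (sym z≡b)))
    drop-head _  _   _  (there z∈) = z∈

  branch-unique : ∀ {x l₁ l₂} → Branch _≤_ x l₁ → Branch _≤_ x l₂ → l₁ ≡ l₂
  branch-unique b₁ b₂ =
    ascending-unique (ascending b₁) (ascending b₂) (complete b₂ ∘ sound b₁) (complete b₁ ∘ sound b₂)

  branch-last : ∀ {x} pre {e} → Branch _≤_ x (pre ++ e ∷ []) → e ≡ x
  branch-last pre b with ∈-++⁻ pre (complete b ≤-refl)
  ... | inj₂ (here x≡e) = sym x≡e
  ... | inj₁ x∈pre      = ⊥-elim (≺⇒≱ (allPairs-++-across pre (ascending b) x∈pre (here refl))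
                                      (sound b (∈-++⁺ʳ pre (here refl))))

  branch-prefix : ∀ {y} pre a post → Branch _≤_ y (pre ++ a ∷ post) → Branch _≤_ a (pre ++ a ∷ [])
  branch-prefix pre a post b = record { ascending = ascending-init ; complete = complete-init ; sound = sound-init }
    where
    reassoc : pre ++ a ∷ post ≡ (pre ++ a ∷ []) ++ post
    reassoc = sym (++-assoc pre (a ∷ []) post)
    ascending-all : AllPairs _≺_ ((pre ++ a ∷ []) ++ post)
    ascending-all = subst (AllPairs _≺_) reassoc (ascending b)
    ascending-init : AllPairs _≺_ (pre ++ a ∷ [])
    ascending-init = proj₁ (allPairs-++⁻ (pre ++ a ∷ []) ascending-all)
    a∈init : a ∈ pre ++ a ∷ []
    a∈init = ∈-++⁺ʳ pre (here refl)
    a∈all : a ∈ pre ++ a ∷ post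
    a∈all = ∈-++⁺ʳ pre (here refl)
    complete-init : ∀ {z} → z ≤ a → z ∈ pre ++ a ∷ []
    complete-init z≤a with ∈-++⁻ (pre ++ a ∷ []) (subst (_ ∈_) reassoc (complete b (≤-trans z≤a (sound b a∈all))))
    ... | inj₁ z∈init = z∈init
    ... | inj₂ z∈post = ⊥-elim (≺⇒≱ (allPairs-++-across (pre ++ a ∷ []) ascending-all a∈init z∈post) z≤a)
    sound-init : ∀ {z} → z ∈ pre ++ a ∷ [] → z ≤ a
    sound-init z∈ with ∈-++⁻ pre z∈
    ... | inj₁ z∈pre      = proj₁ (allPairs-++-across pre ascending-init z∈pre (here refl))
    ... | inj₂ (here refl) = ≤-refl

  -- Insertion sort; the comparisons come from the chain property, so ≤ need not be decidable.
  module _ {C : A → Set ℓ} (chain : ∀ {y z} → C y → C z → (y ≤ z) ⊎ (z ≤ y)) where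

    insert : ∀ a r → C a → All C r → All (a ≢_) r → AllPairs _≺_ r →
             ∃ λ r′ → AllPairs _≺_ r′ × r′ ↭ a ∷ r
    insert a []      _  _         _           _          = a ∷ [] , [] ∷ [] , ↭-refl
    insert a (b ∷ r) ca (cb ∷ cr) (a≢b ∷ a∉r) (b≺ ∷ ≺r) with chain ca cb
    ... | inj₁ a≤b = a ∷ b ∷ r , a≺ ∷ b≺ ∷ ≺r , ↭-refl
      where
      a≺ : All (a ≺_) (b ∷ r)
      a≺ = (a≤b , a≢b) ∷ All.zipWith (λ (b≺c , a≢c) → ≤-trans a≤b (proj₁ b≺c) , a≢c) (b≺ , a∉r)
    ... | inj₂ b≤a with insert a r ca cr a∉r ≺r
    ...   | r′ , ≺r′ , r′↭ar =
      b ∷ r′ , All-resp-↭ (↭-sym r′↭ar) ((b≤a , ≢-sym a≢b) ∷ b≺) ∷ ≺r′ , ↭-trans (prep b r′↭ar) (swap b a ↭-refl)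

    sort : ∀ l → All C l → Unique l → ∃ λ r → AllPairs _≺_ r × r ↭ l
    sort []      _         _          = [] , [] , ↭-refl
    sort (a ∷ l) (ca ∷ cl) (a∉l ∷ !l) with sort l cl !l
    ... | r , ≺r , r↭l with insert a r ca (All-resp-↭ (↭-sym r↭l) cl) (All-resp-↭ (↭-sym r↭l) a∉l) ≺r
    ...   | r′ , ≺r′ , r′↭ar = r′ , ≺r′ , ↭-trans r′↭ar (prep a r↭l)

  branch-exists : ∀ {x} → IsFinite _≤_ (_≤ x) → IsChainSet _≤_ (_≤ x) → ∃ (Branch _≤_ x)
  branch-exists (l , !l , l≈↓x) chain with sort (chain _ _) l (All.tabulate (Equivalence.from (l≈↓x _))) !l
  ... | r , ≺r , r↭l = r , record
    { ascending = ≺r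
    ; complete  = λ z≤x → ∈-resp-↭ (↭-sym r↭l) (Equivalence.to (l≈↓x _) z≤x)
    ; sound     = λ z∈r → Equivalence.from (l≈↓x _) (∈-resp-↭ r↭l z∈r)
    }

  lookup-reflects-≺ : ∀ {l} → AllPairs _≺_ l → ∀ {i j} → lookup l i ≺ lookup l j → i <ᶠ j
  lookup-reflects-≺ ascending {i} {j} li≺lj with <-cmp i j
  ... | tri< i<j _ _ = i<j
  ... | tri≈ _ refl _ = ⊥-elim (proj₂ li≺lj refl)
  ... | tri> _ _ j<i = ⊥-elim (≺⇒≱ li≺lj (proj₁ (allPairs-lookup ascending j<i)))

  branch-lookup-last : ∀ {x} (s : List⁺ A) → Branch _≤_ x (toList s) →
                       lookup (toList s) (fromℕ (length (tail s))) ≡ x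
  branch-lookup-last {x} s b with complete b (≤-refl {x})
  ... | x∈s with <-cmp (Any.index x∈s) (fromℕ (length (tail s)))
  ... | tri< m<top _ _ = ⊥-elim (≺⇒≱ (subst (_≺ _) (sym (lookup-index x∈s)) (allPairs-lookup (ascending b) m<top))
                                    (sound b (∈-lookup (fromℕ (length (tail s))))))
  ... | tri≈ _ m≡top _ = sym (trans (lookup-index x∈s) (cong (lookup (toList s)) m≡top))
  ... | tri> _ _ top<m =
    ⊥-elim (<⇒≱ top<m (subst (toℕ (Any.index x∈s) ≤ℕ_) (sym (toℕ-fromℕ _)) (toℕ≤pred[n] _)))

  edgeGenerated⇒edgeFromBelow : ∀ {E x} (s : List⁺ A) → Branch _≤_ x (toList s) → head s ≢ x →
                                EdgeGenerated E (toList s) → EdgeFromBelow _≤_ E x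
  edgeGenerated⇒edgeFromBelow {E} s b head≢x gen with gen (fromℕ (length (tail s))) top≢0
    where
    top≢0 : toℕ (fromℕ (length (tail s))) ≢ 0
    top≢0 top≡0 =
      head≢x (trans (cong (lookup (toList s)) (sym (toℕ-injective {j = fzero} top≡0))) (branch-lookup-last s b))
  ... | i , i<top , e = lookup (toList s) i ,
                        subst (_ ≺_) (branch-lookup-last s b) (allPairs-lookup (ascending b) i<top) ,
                        subst (E _) (branch-lookup-last s b) e

  module Rooted {r : A} (least : ∀ x → r ≤ x) where

    root-branch : Branch _≤_ r (r ∷ [])
    root-branch = record
      { ascending = [] ∷ []
      ; complete  = λ z≤r → here (antisym z≤r (least _))
      ; sound     = λ { (here refl) → ≤-refl }
      }

    branch-tail-≢-root : ∀ {x h t} → Branch _≤_ x (h ∷ t) → ∀ {z} → z ∈ t → z ≢ r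
    branch-tail-≢-root {h = h} b z∈t refl = ≺⇒≱ (All.lookup (AllPairs.head (ascending b)) z∈t) (least h)

    branch-head : ∀ {x l} → Branch _≤_ x l → ∃ λ t → l ≡ r ∷ t
    branch-head {l = []}    b with complete b (least _)
    ... | ()
    branch-head {l = h ∷ t} b with complete b (least _)
    ... | here r≡h  = t , cong (_∷ t) (sym r≡h)
    ... | there r∈t = ⊥-elim (branch-tail-≢-root b r∈t refl)

    edgeFromBelow⇒edgeGenerated : ∀ {E x l} → (∀ y → y ≢ r → EdgeFromBelow _≤_ E y) →
                                  Branch _≤_ x l → EdgeGenerated E l
    edgeFromBelow⇒edgeGenerated {l = h ∷ t} _   _ fzero      0≢0 = ⊥-elim (0≢0 refl)
    edgeFromBelow⇒edgeGenerated {E} {l = h ∷ t} gen b (fsuc j) _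
      with gen (lookup t j) (branch-tail-≢-root b (∈-lookup j))
    ... | y , y≺tj , e = Any.index y∈ ,
                         lookup-reflects-≺ (ascending b) (subst (_≺ lookup t j) (lookup-index y∈) y≺tj) ,
                         subst (λ w → E w (lookup t j)) (lookup-index y∈) e
      where
      y∈ : y ∈ h ∷ t
      y∈ = complete b (≤-trans (proj₁ y≺tj) (sound b (∈-lookup (fsuc j))))

  module BranchFamily (S : A → List⁺ A) (branch : ∀ x → Branch _≤_ x (toList (S x))) where

    last-S : ∀ x → last (S x) ≡ x
    last-S x with toList-init-last (S x)
    ... | init , e = branch-last init (subst (Branch _≤_ x) e (branch x))

    prefixing-S : ∀ y → Prefixing (toList ∘ S) [] (toList (S y))
    prefixing-S y pre a post e = branch-unique (branch a) (branch-prefix pre a post (subst (Branch _≤_ y) e (branch y)))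

    ≤⇔⊑ : ∀ x y → x ≤ y ⇔ S x ⊑ S y
    ≤⇔⊑ x y = mk⇔ (prefixing-⊑ (prefixing-S y) ∘ complete (branch y))
                  (λ (u , e) → sound (branch y) (subst (x ∈_) e (∈-++⁺ˡ (complete (branch x) ≤-refl))))

module PrefixOrder {ℓ : Level} {A : Set ℓ} (S : A → List⁺ A) (last-S : ∀ x → last (S x) ≡ x)
                   (prefixing : ∀ y → Prefixing (toList ∘ S) [] (toList (S y))) where

  _≼_ : A → A → Set ℓ
  x ≼ y = S x ⊑ S y

  S-injective : ∀ {x y} → toList (S x) ≡ toList (S y) → x ≡ y
  S-injective {x} {y} e = trans (sym (last-S x)) (trans (cong last (toList-injective e)) (last-S y))

  ∈-S : ∀ x → x ∈ toList (S x)
  ∈-S x with toList-init-last (S x)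
  ... | init , e = subst (x ∈_) (sym e) (∈-++⁺ʳ init (here (sym (last-S x))))

  ≼-isPartialOrder : IsPartialOrder _≡_ _≼_
  ≼-isPartialOrder = record
    { isPreorder = record
      { isEquivalence = isEquivalence
      ; reflexive     = λ { {x} refl → [] , ++-identityʳ (toList (S x)) }
      ; trans         = λ { {x} (u , e₁) (v , e₂) →
                            u ++ v , trans (sym (++-assoc (toList (S x)) u v)) (trans (cong (_++ v) e₁) e₂) }
      }
    ; antisym = λ { {x} (_ , e₁) (_ , e₂) → S-injective (++-antisym (toList (S x)) e₁ e₂) }
    }

  ≼-downsets-chain : ∀ y → IsChainSet _≼_ (_≼ y)
  ≼-downsets-chain y z w (_ , e₁) (_ , e₂) =
    ++-prefixes-comparable (toList (S z)) (toList (S w)) (trans e₁ (sym e₂))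

  ascending-suffix : ∀ {y} pre rest → toList (S y) ≡ pre ++ rest → AllPairs (Strict _≼_) rest
  ascending-suffix         pre []         _ = []
  ascending-suffix {y} pre (a ∷ rest) e =
    All.tabulate a≺ ∷ ascending-suffix (pre ++ a ∷ []) rest (trans e (sym (++-assoc pre (a ∷ []) rest)))
    where
    a≺ : ∀ {b} → b ∈ rest → Strict _≼_ a b
    a≺ {b} b∈ with ∈-∃++ b∈
    ... | mid , post , rest≡ =
      (mid ++ b ∷ [] , Sa++≡Sb) ,
      λ { refl → b∷[]≢[] (++-conicalʳ mid (b ∷ []) (++-identityʳ-unique _ (sym Sa++≡Sb))) }
      where
      b∷[]≢[] : b ∷ [] ≢ []
      b∷[]≢[] ()
      Sa++≡Sb : toList (S a) ++ mid ++ b ∷ [] ≡ toList (S b)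
      Sa++≡Sb = begin
        toList (S a) ++ mid ++ b ∷ []     ≡⟨ cong (_++ mid ++ b ∷ []) (prefixing y pre a rest e) ⟩
        (pre ++ a ∷ []) ++ mid ++ b ∷ []  ≡⟨ ++-assoc pre (a ∷ []) (mid ++ b ∷ []) ⟩
        pre ++ a ∷ mid ++ b ∷ []          ≡⟨ sym (++-assoc pre (a ∷ mid) (b ∷ [])) ⟩
        (pre ++ a ∷ mid) ++ b ∷ []        ≡⟨ sym (prefixing y (pre ++ a ∷ mid) b post Sy≡) ⟩
        toList (S b)                      ∎
        where
        Sy≡ : toList (S y) ≡ (pre ++ a ∷ mid) ++ b ∷ post
        Sy≡ = trans e (trans (cong (λ r → pre ++ a ∷ r) rest≡) (sym (++-assoc pre (a ∷ mid) (b ∷ post))))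

  branch : ∀ y → Branch _≼_ y (toList (S y))
  branch y = record
    { ascending = ascending-suffix [] (toList (S y)) refl
    ; complete  = λ { {z} (_ , e) → subst (z ∈_) e (∈-++⁺ˡ (∈-S z)) }
    ; sound     = prefixing-⊑ (prefixing y)
    }

  ≼-comparable-equal-length : ∀ {x y} → (x ≼ y) ⊎ (y ≼ x) →
                              length (toList (S x)) ≡ length (toList (S y)) → x ≡ y
  ≼-comparable-equal-length {x}     (inj₁ (_ , e)) same =
    S-injective (++-prefix-of-equal-length (toList (S x)) e same)
  ≼-comparable-equal-length {y = y} (inj₂ (_ , e)) same =
    sym (S-injective (++-prefix-of-equal-length (toList (S y)) e (sym same)))

  ≼-height : ∀ {n} → (∀ x → List⁺.length (S x) ≤ℕ n) → HeightAtMost _≼_ n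
  ≼-height {n} bounded l unique chain with length l ≤? n
  ... | yes l≤n = l≤n
  ... | no  l≰n with pigeonhole (≰⇒> l≰n) (λ i → fromℕ< (bounded (lookup l i)))
  ...   | i , j , i<j , same-length =
    ⊥-elim (allPairs-lookup unique i<j (≼-comparable-equal-length (chain _ _ (∈-lookup i) (∈-lookup j))
                                                                (cong suc (fromℕ<-injective _ _ _ _ same-length))))

module CoalgebraToGenTreeCover {ℓ : Level} {σ : Set ℓ} {k : ℕ} {𝒜 : PStructure σ} (c : Coalgebra k 𝒜) where
  open PStructure 𝒜
  open Coalgebra c

  S : Carrier → List⁺ Carrier
  S x = seq k 𝒜 (α x)

  open PrefixOrder S counit (λ y → Equivalence.to (δ≡map⇔Prefixing S (S y)) (coassoc y)) public
  open BranchProperties ≼-isPartialOrder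

  head-S : ∀ x → head (S x) ≡ point
  head-S x = InHk.start (proj₂ (α x))

  point-≼ : ∀ x → point ≼ x
  point-≼ x = tail (S x) , (begin
    toList (S point) ++ tail (S x) ≡⟨ cong (λ s → toList s ++ tail (S x)) pres-pt ⟩
    point ∷ tail (S x)             ≡⟨ cong (_∷ tail (S x)) (sym (head-S x)) ⟩
    toList (S x)                   ∎)

  treeCover : TreeCover 𝒜
  treeCover = record
    { _≤_      = _≼_
    ; isForest = record
      { isPartialOrder = ≼-isPartialOrder
      ; predFinite     = λ y → branch-finite _≼_ (branch y)
      ; predChain      = ≼-downsets-chain
      }
    ; least    = point-≼
    ; covers   = λ x y → proj₁ ∘ pres-E x y
    }

  generated : Generated 𝒜 treeCover
  generated x x≢point = edgeGenerated⇒edgeFromBelow {E = E} (S x) (branch x)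
                          (λ head≡x → x≢point (trans (sym head≡x) (head-S x))) (InHk.gen (proj₂ (α x)))

  genTreeCover : GenTreeCover k 𝒜
  genTreeCover = record
    { cover     = treeCover
    ; generated = generated
    ; height    = ≼-height (InHk.len ∘ proj₂ ∘ α)
    }

module GenTreeCoverToCoalgebra {ℓ : Level} {σ : Set ℓ} {k : ℕ} {𝒜 : PStructure σ} (T : GenTreeCover k 𝒜) where
  open PStructure 𝒜
  open GenTreeCover T
  open TreeCover cover
  open IsForest isForest
  open BranchProperties isPartialOrder public
  open Rooted least
  open Branch

  branch-of : ∀ x → ∃ λ t → Branch _≤_ x (point ∷ t)
  branch-of x with branch-exists (predFinite x) (predChain x)
  ... | _ , b with branch-head b
  ...   | t , refl = t , b

  S : Carrier → List⁺ Carrier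
  S x = point ∷ proj₁ (branch-of x)

  branch-S : ∀ x → Branch _≤_ x (toList (S x))
  branch-S x = proj₂ (branch-of x)

  open BranchFamily S branch-S public

  inHk : ∀ x → InHk k 𝒜 (S x)
  inHk x = record
    { len   = height (toList (S x)) (AllPairs.map proj₂ (ascending (branch-S x)))
                (λ y z y∈ z∈ → predChain x y z (sound (branch-S x) y∈) (sound (branch-S x) z∈))
    ; start = refl
    ; gen   = edgeFromBelow⇒edgeGenerated generated (branch-S x)
    }

  coalgebra : Coalgebra k 𝒜
  coalgebra = record
    { α       = λ x → S x , inHk x
    ; pres-P  = λ p x → subst (P p) (sym (last-S x))
    ; pres-E  = λ x y e → Sum.map (Equivalence.to (≤⇔⊑ x y)) (Equivalence.to (≤⇔⊑ y x)) (covers x y e) ,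
                          subst₂ E (sym (last-S x)) (sym (last-S y)) e
    ; pres-pt = toList-injective (branch-unique (branch-S point) root-branch)
    ; counit  = last-S
    ; coassoc = λ x → Equivalence.from (δ≡map⇔Prefixing S (S x)) (prefixing-S x)
    }

module Correspondence {ℓ : Level} {σ : Set ℓ} (k : ℕ) (𝒜 : PStructure σ) where
  private
    module Coalg = Setoid (CoalgSetoid k 𝒜)
    module Cover = Setoid (GenTreeCoverSetoid k 𝒜)
    module ToCover = CoalgebraToGenTreeCover {k = k} {𝒜}
    module ToCoalg = GenTreeCoverToCoalgebra {k = k} {𝒜}

  toGenTreeCover : Coalgebra k 𝒜 → GenTreeCover k 𝒜
  toGenTreeCover = ToCover.genTreeCover

  toCoalgebra : GenTreeCover k 𝒜 → Coalgebra k 𝒜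
  toCoalgebra = ToCoalg.coalgebra

  toGenTreeCover-cong : Congruent Coalg._≈_ Cover._≈_ toGenTreeCover
  toGenTreeCover-cong c≈d x y = mk⇔ (subst₂ _⊑_ (c≈d x) (c≈d y)) (subst₂ _⊑_ (sym (c≈d x)) (sym (c≈d y)))

  toCoalgebra-cong : Congruent Cover._≈_ Coalg._≈_ toCoalgebra
  toCoalgebra-cong {T} {U} T≈U x =
    toList-injective (ToCoalg.branch-unique U (Branch-resp-⇔ T≈U (ToCoalg.branch-S T x)) (ToCoalg.branch-S U x))

  toGenTreeCover∘toCoalgebra : StrictlyInverseˡ Cover._≈_ toGenTreeCover toCoalgebra
  toGenTreeCover∘toCoalgebra T x y = ⇔-sym (ToCoalg.≤⇔⊑ T x y)

  toCoalgebra∘toGenTreeCover : StrictlyInverseʳ Coalg._≈_ toGenTreeCover toCoalgebra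
  toCoalgebra∘toGenTreeCover c x =
    toList-injective (ToCoalg.branch-unique (toGenTreeCover c) (ToCoalg.branch-S (toGenTreeCover c) x) (ToCover.branch c x))

  inverseˡ : Inverseˡ Coalg._≈_ Cover._≈_ toGenTreeCover toCoalgebra
  inverseˡ {T} {c} c≈fromT = Cover.trans {toGenTreeCover c} {toGenTreeCover (toCoalgebra T)} {T}
    (toGenTreeCover-cong {c} {toCoalgebra T} c≈fromT) (toGenTreeCover∘toCoalgebra T)

  inverseʳ : Inverseʳ Coalg._≈_ Cover._≈_ toGenTreeCover toCoalgebra
  inverseʳ {c} {T} T≈toc = Coalg.trans {toCoalgebra T} {toCoalgebra (toGenTreeCover c)} {c}
    (toCoalgebra-cong {T} {toGenTreeCover c} T≈toc) (toCoalgebra∘toGenTreeCover c)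

mainTheorem15 : {ℓ : Level} {σ : Set ℓ} (k : ℕ) → 0 < k → (𝒜 : PStructure σ) →
                  Inverse (CoalgSetoid k 𝒜) (GenTreeCoverSetoid k 𝒜)
mainTheorem15 k _ 𝒜 = record
  { to        = toGenTreeCover
  ; from      = toCoalgebra
  ; to-cong   = λ {c d} → toGenTreeCover-cong {c} {d}
  ; from-cong = λ {T U} → toCoalgebra-cong {T} {U}
  ; inverse   = (λ {T c} → inverseˡ {T} {c}) , (λ {c T} → inverseʳ {c} {T})
  }
  where open Correspondence k 𝒜
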